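{- Let $P$ be a path with endpoints $u$ and $v$ and let $L$ be a list assignment on $P$ with $|L(x)|=4$ for all $x\in V(P)$. Then there is an injective function $h:\binom{L(u)}{2}\to\binom{L(v)}{2}$ such that for every $p\in\binom{L(u)}{2}$, the precolouring $\phi(u)=p$, $\phi(v)=h(p)$ extends to a $2$-tuple $L$-colouring of $P$.
   Context: $\binom{S}{2}$ denotes the set of $2$-element subsets of $S$. A $2$-tuple $L$-colouring assigns each vertex $x$ a $2$-subset of $L(x)$ with adjacent vertices receiving disjoint sets. If $P$ has one vertex then $u=v$. -}

module Defs where

open import Data.Nat using (ℕ; suc; _<_)
open import Data.Fin using (Fin; zero; suc; inject₁; fromℕ)
open import Data.List using (List; length)
open import Data.List.Membership.Propositional using (_∈_)
open import Data.List.Relation.Unary.Unique.Propositional using (Unique)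
open import Data.Product using (Σ; _×_; _,_; proj₁)
open import Relation.Binary.PropositionalEquality using (_≡_; _≢_)

-- Colours are natural numbers.  The path P on suc n vertices has vertex set
-- Fin (suc n), edges {inject₁ i , suc i} for i : Fin n, endpoints
-- u = zero and v = fromℕ n (u = v when n = 0).

ListAssignment : ℕ → Set
ListAssignment n = Fin (suc n) → List ℕ

Size4 : ∀ {n} → ListAssignment n → Set
Size4 L = ∀ x → Unique (L x) × length (L x) ≡ 4

-- A 2-element subset {a , b} of S, presented canonically with a < b.
record Two (S : List ℕ) : Set where
  constructor two
  field
    fst : ℕ
    snd : ℕ
    fst<snd : fst < snd
    fst∈ : fst ∈ S
    snd∈ : snd ∈ S
open Two public

elems : ∀ {S} → Two S → ℕ × ℕ
elems p = fst p , snd p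

SameSet : ∀ {S T} → Two S → Two T → Set
SameSet p q = elems p ≡ elems q

Disjoint : ∀ {S T} → Two S → Two T → Set
Disjoint p q = (fst p ≢ fst q) × (fst p ≢ snd q) × (snd p ≢ fst q) × (snd p ≢ snd q)

record TupleColouring {n} (L : ListAssignment n) : Set where
  field
    col : (x : Fin (suc n)) → Two (L x)
    proper : (i : Fin n) → Disjoint (col (inject₁ i)) (col (suc i))
open TupleColouring public

Injective2 : ∀ {S T} → (Two S → Two T) → Set
Injective2 h = ∀ p q → SameSet (h p) (h q) → SameSet p q

-- Along an edge xy of the path choose an injection σ : L(x) → L(y) that never sends a colour
-- of L(x) to a different colour of L(x): keep the common colours and send the others to colours
-- of L(y) ∖ L(x), of which there are enough since |L(x)| ≤ |L(y)|.  Since |L(x)| = 4, the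
-- complement of a 2-set p is again a 2-set, and g(p) := σ(L(x) ∖ p) is injective and disjoint
-- from p: a colour of σ(L(x) ∖ p) lying in L(x) is fixed by σ, hence lies outside p.
-- Composing these edge maps along the path gives h, and the intermediate images of p
-- form the colouring.
module Submission where

open import Defs
open import Data.Nat using (ℕ; zero; suc; _≤_; _<_; z≤n; s≤s; s≤s⁻¹)
open import Data.Nat.Properties
  using (≤-trans; ≤-antisym; ≤-reflexive; suc-injective; <-cmp; <⇒≢; <⇒≱; <-asym)
import Data.Nat.Properties as ℕ
open import Data.Fin using (zero; suc; fromℕ)
open import Data.List using (List; []; _∷_; length; filter)
open import Data.List.Properties using (filter-notAll)
open import Data.List.Membership.Propositional using (_∈_; _∉_; find)
open import Data.List.Membership.Propositional.Properties using (∈-filter⁺; ∈-filter⁻)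
open import Data.List.Relation.Binary.Subset.Propositional using (_⊆_)
open import Data.List.Relation.Unary.Any as Any using (here; there; any?)
open import Data.List.Relation.Unary.All as All using ([]; _∷_)
open import Data.List.Relation.Unary.All.Properties using (¬Any⇒All¬)
open import Data.List.Relation.Unary.AllPairs using ([]; _∷_)
open import Data.List.Relation.Unary.Unique.Propositional using (Unique)
open import Data.List.Relation.Unary.Unique.Propositional.Properties
  using (filter⁺; Unique[x∷xs]⇒x∉xs)
open import Data.Product using (Σ; ∃; _×_; _,_; proj₁; proj₂)
open import Data.Sum as Sum using (_⊎_; inj₁; inj₂; [_,_]; swap)
open import Data.Empty using (⊥)
open import Function using (_∘_; id)
open import Relation.Binary.Definitions using (DecidableEquality; tri<; tri≈; tri>)
open import Relation.Binary.PropositionalEquality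
  using (_≡_; _≢_; refl; sym; trans; cong; cong₂; subst; subst₂; ≢-sym; module ≡-Reasoning)
open import Relation.Nullary using (¬_; Dec; yes; no; ¬?; contradiction)
open import Relation.Nullary.Decidable using (_⊎-dec_; decidable-stable)

module DistinctLists {X : Set} (_≟_ : DecidableEquality X) where

  open import Data.List.Membership.DecPropositional _≟_ using (_∈?_)

  private variable
    x y : X
    xs ys : List X

  infixl 6 _∖_
  _∖_ : List X → X → List X
  xs ∖ x = filter (λ y → ¬? (y ≟ x)) xs

  ∈-∖⁺ : y ∈ xs → y ≢ x → y ∈ xs ∖ x
  ∈-∖⁺ {x = x} = ∈-filter⁺ (λ y → ¬? (y ≟ x))

  ∈-∖⁻ : y ∈ xs ∖ x → y ∈ xs × y ≢ x
  ∈-∖⁻ {x = x} = ∈-filter⁻ (λ y → ¬? (y ≟ x))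

  unique-∖ : Unique xs → Unique (xs ∖ x)
  unique-∖ {x = x} = filter⁺ (λ y → ¬? (y ≟ x))

  ⊆-∷∖ : xs ⊆ x ∷ xs ∖ x
  ⊆-∷∖ {x = x} {y} y∈xs with y ≟ x
  ... | yes y≡x = here y≡x
  ... | no  y≢x = there (∈-∖⁺ y∈xs y≢x)

  length-∖-< : x ∈ xs → length (xs ∖ x) < length xs
  length-∖-< {x = x} {xs} x∈xs =
    filter-notAll (λ y → ¬? (y ≟ x)) xs (Any.map (λ x≡y y≢x → y≢x (sym x≡y)) x∈xs)

  unique⊆⇒length≤ : Unique xs → xs ⊆ ys → length xs ≤ length ys
  unique⊆⇒length≤ [] _ = z≤n
  unique⊆⇒length≤ {x ∷ xs} {ys} (x≢xs ∷ u) xs⊆ys =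
    ≤-trans (s≤s (unique⊆⇒length≤ u xs⊆ys∖x)) (length-∖-< {xs = ys} (xs⊆ys (here refl)))
    where
    xs⊆ys∖x : xs ⊆ ys ∖ x
    xs⊆ys∖x y∈xs = ∈-∖⁺ (xs⊆ys (there y∈xs)) (≢-sym (All.lookup x≢xs y∈xs))

  length-∖ : Unique xs → x ∈ xs → length xs ≡ suc (length (xs ∖ x))
  length-∖ u x∈xs = ≤-antisym (unique⊆⇒length≤ u ⊆-∷∖) (length-∖-< x∈xs)

  record FixingInjection (A B : List X) : Set where
    field
      σ : X → X
      σ-∈ : x ∈ A → σ x ∈ B
      σ-injective : x ∈ A → y ∈ A → σ x ≡ σ y → x ≡ y
      σ-fixes : x ∈ A → σ x ∈ A → σ x ≡ x

  freshTarget : ∀ {a A B} → Unique B → length (a ∷ A) ≤ length B →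
    ∃ λ b → b ∈ B × (b ∈ a ∷ A → b ≡ a) × (a ∈ B → b ≡ a)
  freshTarget {a} {A} {B} uB |aA|≤|B| with a ∈? B
  ... | yes a∈B = a , a∈B , (λ _ → refl) , (λ _ → refl)
  ... | no  a∉B with any? (λ y → ¬? (y ∈? a ∷ A)) B
  ...   | yes new = let b , b∈B , b∉aA = find new in
                    b , b∈B , (λ b∈aA → contradiction b∈aA b∉aA)
                      , (λ a∈B → contradiction a∈B a∉B)
  ...   | no ¬new = contradiction (unique⊆⇒length≤ uB B⊆A) (<⇒≱ |aA|≤|B|)
    where
    B⊆A : B ⊆ A
    B⊆A y∈B with decidable-stable (_ ∈? a ∷ A) (All.lookup (¬Any⇒All¬ B ¬new) y∈B)
    ... | here refl = contradiction y∈B a∉B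
    ... | there y∈A = y∈A

  ∷-fixingInjection : ∀ {a A b B} → a ∉ A → b ∈ B → (b ∈ a ∷ A → b ≡ a) → (a ∈ B → b ≡ a) →
    FixingInjection A (B ∖ b) → FixingInjection (a ∷ A) B
  ∷-fixingInjection {a} {A} {b} {B} a∉A b∈B b∈aA⇒b≡a a∈B⇒b≡a F =
    record { σ = τ ; σ-∈ = τ-∈ ; σ-injective = τ-injective ; σ-fixes = τ-fixes }
    where
    open FixingInjection F

    τ : X → X
    τ x with x ≟ a
    ... | yes _ = b
    ... | no  _ = σ x

    τ-a : τ a ≡ b
    τ-a with a ≟ a
    ... | yes _   = refl
    ... | no  a≢a = contradiction refl a≢a

    τ-A : x ∈ A → τ x ≡ σ x
    τ-A {x} x∈A with x ≟ a
    ... | yes refl = contradiction x∈A a∉A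
    ... | no  _    = refl

    σ-∈B : x ∈ A → σ x ∈ B
    σ-∈B = proj₁ ∘ ∈-∖⁻ {xs = B} ∘ σ-∈

    σ-≢b : x ∈ A → σ x ≢ b
    σ-≢b = proj₂ ∘ ∈-∖⁻ {xs = B} ∘ σ-∈

    τ-a≢ : y ∈ A → τ a ≢ τ y
    τ-a≢ y∈A τa≡τy = σ-≢b y∈A (trans (sym (τ-A y∈A)) (trans (sym τa≡τy) τ-a))

    τ-∈ : x ∈ a ∷ A → τ x ∈ B
    τ-∈ (here refl) = subst (_∈ B) (sym τ-a) b∈B
    τ-∈ (there x∈A) = subst (_∈ B) (sym (τ-A x∈A)) (σ-∈B x∈A)

    τ-injective : x ∈ a ∷ A → y ∈ a ∷ A → τ x ≡ τ y → x ≡ y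
    τ-injective (here refl) (here refl) _ = refl
    τ-injective (here refl) (there y∈A) e = contradiction e (τ-a≢ y∈A)
    τ-injective (there x∈A) (here refl) e = contradiction (sym e) (τ-a≢ x∈A)
    τ-injective (there x∈A) (there y∈A) e =
      σ-injective x∈A y∈A (trans (sym (τ-A x∈A)) (trans e (τ-A y∈A)))

    τ-fixes : x ∈ a ∷ A → τ x ∈ a ∷ A → τ x ≡ x
    τ-fixes (here refl) τa∈aA = trans τ-a (b∈aA⇒b≡a (subst (_∈ a ∷ A) τ-a τa∈aA))
    τ-fixes {x} (there x∈A) τx∈aA with subst (_∈ a ∷ A) (τ-A x∈A) τx∈aA
    ... | here σx≡a  = contradiction
                         (trans σx≡a (sym (a∈B⇒b≡a (subst (_∈ B) σx≡a (σ-∈B x∈A)))))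
                         (σ-≢b x∈A)
    ... | there σx∈A = trans (τ-A x∈A) (σ-fixes x∈A σx∈A)

  fixingInjection : ∀ {A B} → Unique A → Unique B → length A ≤ length B → FixingInjection A B
  fixingInjection {[]} _ _ _ =
    record { σ = id ; σ-∈ = λ () ; σ-injective = λ () ; σ-fixes = λ () }
  fixingInjection {a ∷ A} {B} uaA@(_ ∷ uA) uB |aA|≤|B| =
    let b , b∈B , b∈aA⇒b≡a , a∈B⇒b≡a = freshTarget uB |aA|≤|B|
        |A|≤|B∖b| = s≤s⁻¹ (subst (_ ≤_) (length-∖ uB b∈B) |aA|≤|B|)
    in ∷-fixingInjection (Unique[x∷xs]⇒x∉xs uaA) b∈B b∈aA⇒b≡a a∈B⇒b≡a
         (fixingInjection uA (unique-∖ uB) |A|≤|B∖b|)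

open DistinctLists ℕ._≟_

private variable
  S T : List ℕ
  x y z : ℕ

infix 4 _∈₂_ _∈₂?_
_∈₂_ : ℕ → Two S → Set
x ∈₂ p = x ≡ fst p ⊎ x ≡ snd p

_∈₂?_ : (x : ℕ) (p : Two S) → Dec (x ∈₂ p)
x ∈₂? p = (x ℕ.≟ fst p) ⊎-dec (x ℕ.≟ snd p)

∈₂⇒∈ : (p : Two S) → x ∈₂ p → x ∈ S
∈₂⇒∈ p (inj₁ refl) = fst∈ p
∈₂⇒∈ p (inj₂ refl) = snd∈ p

SameSet⇒⊆₂ : (p : Two S) (q : Two T) → SameSet p q → x ∈₂ p → x ∈₂ q
SameSet⇒⊆₂ p q p≐q (inj₁ refl) = inj₁ (cong proj₁ p≐q)
SameSet⇒⊆₂ p q p≐q (inj₂ refl) = inj₂ (cong proj₂ p≐q)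

⊆₂⇒SameSet : (p : Two S) (q : Two T) → (∀ {x} → x ∈₂ p → x ∈₂ q) → SameSet p q
⊆₂⇒SameSet p q p⊆q with p⊆q (inj₁ refl) | p⊆q (inj₂ refl)
... | inj₁ e₁ | inj₂ e₂ = cong₂ _,_ e₁ e₂
... | inj₁ e₁ | inj₁ e₂ = contradiction (trans e₁ (sym e₂)) (<⇒≢ (fst<snd p))
... | inj₂ e₁ | inj₂ e₂ = contradiction (trans e₁ (sym e₂)) (<⇒≢ (fst<snd p))
... | inj₂ e₁ | inj₁ e₂ =
  contradiction (subst₂ _<_ (sym e₂) (sym e₁) (fst<snd q)) (<-asym (fst<snd p))

disjoint : (p : Two S) (q : Two T) → (∀ {x} → x ∈₂ p → x ∈₂ q → ⊥) → Disjoint p q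
disjoint p q ¬both =
  (λ e → ¬both (inj₁ refl) (inj₁ e)) , (λ e → ¬both (inj₁ refl) (inj₂ e)) ,
  (λ e → ¬both (inj₂ refl) (inj₁ e)) , (λ e → ¬both (inj₂ refl) (inj₂ e))

Disjoint⇒¬∈₂both : (p : Two S) (q : Two T) → Disjoint p q → x ∈₂ p → x ∈₂ q → ⊥
Disjoint⇒¬∈₂both p q (d₁ , _  , _  , _ ) (inj₁ refl) (inj₁ e) = d₁ e
Disjoint⇒¬∈₂both p q (_  , d₂ , _  , _ ) (inj₁ refl) (inj₂ e) = d₂ e
Disjoint⇒¬∈₂both p q (_  , _  , d₃ , _ ) (inj₂ refl) (inj₁ e) = d₃ e
Disjoint⇒¬∈₂both p q (_  , _  , _  , d₄) (inj₂ refl) (inj₂ e) = d₄ e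

Disjoint-respʳ : ∀ {U} (p : Two S) (q : Two T) (q′ : Two U) →
  Disjoint p q → SameSet q q′ → Disjoint p q′
Disjoint-respʳ p q q′ p#q q≐q′ = disjoint p q′ λ x∈p x∈q′ →
  Disjoint⇒¬∈₂both p q p#q x∈p (SameSet⇒⊆₂ q′ q (sym q≐q′) x∈q′)

pair : x ∈ S → y ∈ S → x ≢ y → Two S
pair {x} {y = y} x∈S y∈S x≢y with <-cmp x y
... | tri< x<y _ _ = two x y x<y x∈S y∈S
... | tri≈ _ x≡y _ = contradiction x≡y x≢y
... | tri> _ _ y<x = two y x y<x y∈S x∈S

module _ (x∈S : x ∈ S) (y∈S : y ∈ S) (x≢y : x ≢ y) where

  ∈₂-pair⁺ : z ≡ x ⊎ z ≡ y → z ∈₂ pair x∈S y∈S x≢y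
  ∈₂-pair⁺ with <-cmp x y
  ... | tri< _ _ _   = id
  ... | tri≈ _ x≡y _ = contradiction x≡y x≢y
  ... | tri> _ _ _   = swap

  ∈₂-pair⁻ : z ∈₂ pair x∈S y∈S x≢y → z ≡ x ⊎ z ≡ y
  ∈₂-pair⁻ with <-cmp x y
  ... | tri< _ _ _   = id
  ... | tri≈ _ x≡y _ = contradiction x≡y x≢y
  ... | tri> _ _ _   = swap

widen : S ⊆ T → Two S → Two T
widen S⊆T p = two (fst p) (snd p) (fst<snd p) (S⊆T (fst∈ p)) (S⊆T (snd∈ p))

asTwo : Unique S → length S ≡ 2 → Two S
asTwo {c ∷ d ∷ []} ((c≢d ∷ []) ∷ _) refl = pair (here refl) (there (here refl)) c≢d

∈₂-asTwo : (u : Unique S) (|S|≡2 : length S ≡ 2) → x ∈ S → x ∈₂ asTwo u |S|≡2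
∈₂-asTwo {c ∷ d ∷ []} ((c≢d ∷ []) ∷ _) refl (here x≡c) =
  ∈₂-pair⁺ (here refl) (there (here refl)) c≢d (inj₁ x≡c)
∈₂-asTwo {c ∷ d ∷ []} ((c≢d ∷ []) ∷ _) refl (there (here x≡d)) =
  ∈₂-pair⁺ (here refl) (there (here refl)) c≢d (inj₂ x≡d)

module Complement (uS : Unique S) (|S|≡4 : length S ≡ 4) where

  rest : Two S → List ℕ
  rest p = S ∖ fst p ∖ snd p

  rest⊆S : (p : Two S) → rest p ⊆ S
  rest⊆S p = proj₁ ∘ ∈-∖⁻ ∘ proj₁ ∘ ∈-∖⁻

  length-rest : (p : Two S) → length (rest p) ≡ 2
  length-rest p = sym (suc-injective (suc-injective (begin
    4                                   ≡⟨ sym |S|≡4 ⟩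
    length S                            ≡⟨ length-∖ uS (fst∈ p) ⟩
    suc (length (S ∖ fst p))            ≡⟨ cong suc (length-∖ (unique-∖ uS) snd∈S∖fst) ⟩
    suc (suc (length (rest p)))         ∎)))
    where
    open ≡-Reasoning
    snd∈S∖fst : snd p ∈ S ∖ fst p
    snd∈S∖fst = ∈-∖⁺ (snd∈ p) (≢-sym (<⇒≢ (fst<snd p)))

  restAsTwo : (p : Two S) → Two (rest p)
  restAsTwo p = asTwo (unique-∖ (unique-∖ uS)) (length-rest p)

  complement : Two S → Two S
  complement p = widen (rest⊆S p) (restAsTwo p)

  ∉₂-complement : (p : Two S) → x ∈₂ complement p → ¬ x ∈₂ p
  ∉₂-complement p x∈p̄ with ∈-∖⁻ {xs = S ∖ fst p} (∈₂⇒∈ (restAsTwo p) x∈p̄)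
  ... | x∈S∖fst , x≢snd = [ proj₂ (∈-∖⁻ {xs = S} x∈S∖fst) , x≢snd ]

  ∈₂-complement : (p : Two S) → x ∈ S → ¬ x ∈₂ p → x ∈₂ complement p
  ∈₂-complement p x∈S x∉p =
    ∈₂-asTwo (unique-∖ (unique-∖ uS)) (length-rest p)
      (∈-∖⁺ (∈-∖⁺ x∈S (x∉p ∘ inj₁)) (x∉p ∘ inj₂))

module Image {A B : List ℕ} (F : FixingInjection A B) where

  open FixingInjection F

  σ-≢ : (p : Two A) → σ (fst p) ≢ σ (snd p)
  σ-≢ p = <⇒≢ (fst<snd p) ∘ σ-injective (fst∈ p) (snd∈ p)

  image : Two A → Two B
  image p = pair (σ-∈ (fst∈ p)) (σ-∈ (snd∈ p)) (σ-≢ p)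

  ∈₂-image⁺ : (p : Two A) → x ∈₂ p → σ x ∈₂ image p
  ∈₂-image⁺ p x∈p =
    ∈₂-pair⁺ (σ-∈ (fst∈ p)) (σ-∈ (snd∈ p)) (σ-≢ p) (Sum.map (cong σ) (cong σ) x∈p)

  ∈₂-image⁻ : (p : Two A) → y ∈₂ image p → ∃ λ x → x ∈₂ p × y ≡ σ x
  ∈₂-image⁻ p y∈σp with ∈₂-pair⁻ (σ-∈ (fst∈ p)) (σ-∈ (snd∈ p)) (σ-≢ p) y∈σp
  ... | inj₁ y≡σfst = fst p , inj₁ refl , y≡σfst
  ... | inj₂ y≡σsnd = snd p , inj₂ refl , y≡σsnd

edgeMap : ∀ {A B} → Unique A → length A ≡ 4 → Unique B → 4 ≤ length B →
  Σ (Two A → Two B) λ g → Injective2 g × (∀ p → Disjoint p (g p))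
edgeMap {A} {B} uA |A|≡4 uB 4≤|B| = g , g-injective , g-disjoint
  where
  F : FixingInjection A B
  F = fixingInjection uA uB (subst (_≤ length B) (sym |A|≡4) 4≤|B|)
  open FixingInjection F
  open Complement uA |A|≡4
  open Image F

  g : Two A → Two B
  g = image ∘ complement

  g-disjoint : ∀ p → Disjoint p (g p)
  g-disjoint p = disjoint p (g p) λ x∈p x∈gp →
    let z , z∈p̄ , x≡σz = ∈₂-image⁻ (complement p) x∈gp
        z∈A = ∈₂⇒∈ (complement p) z∈p̄
        σz≡z = σ-fixes z∈A (subst (_∈ A) x≡σz (∈₂⇒∈ p x∈p))
    in ∉₂-complement p z∈p̄ (subst (_∈₂ p) (trans x≡σz σz≡z) x∈p)

  g-injective : Injective2 g
  g-injective p q gp≐gq = ⊆₂⇒SameSet p q λ {x} x∈p → decidable-stable (x ∈₂? q) λ x∉q →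
    let x∈A = ∈₂⇒∈ p x∈p
        σx∈gq = ∈₂-image⁺ (complement q) (∈₂-complement q x∈A x∉q)
        σx∈gp = SameSet⇒⊆₂ (g q) (g p) (sym gp≐gq) σx∈gq
        z , z∈p̄ , σx≡σz = ∈₂-image⁻ (complement p) σx∈gp
        x≡z = σ-injective x∈A (∈₂⇒∈ (complement p) z∈p̄) σx≡σz
    in ∉₂-complement p (subst (_∈₂ complement p) (sym x≡z) z∈p̄) x∈p

single : {L : ListAssignment 0} → Two (L zero) → TupleColouring L
single p = record { col = λ { zero → p } ; proper = λ () }

cons : ∀ {n} {L : ListAssignment (suc n)} (p : Two (L zero))
  (φ : TupleColouring (λ x → L (suc x))) → Disjoint p (col φ zero) → TupleColouring L
cons p φ p#φ = record
  { col    = λ { zero → p ; (suc x) → col φ x }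
  ; proper = λ { zero → p#φ ; (suc i) → proper φ i }
  }

lemma5p3 : (n : ℕ) (L : ListAssignment n) → Size4 L →
  Σ (Two (L zero) → Two (L (fromℕ n))) λ h →
    Injective2 h ×
    ((p : Two (L zero)) → Σ (TupleColouring L) λ φ →
       SameSet (col φ zero) p × SameSet (col φ (fromℕ n)) (h p))
lemma5p3 zero L _ = id , (λ _ _ → id) , λ p → single p , refl , refl
lemma5p3 (suc n) L size4 =
  let h , h-injective , h-extends = lemma5p3 n (λ x → L (suc x)) (λ x → size4 (suc x))
      u₀ , |L₀|≡4 = size4 zero
      u₁ , |L₁|≡4 = size4 (suc zero)
      g , g-injective , g-disjoint = edgeMap u₀ |L₀|≡4 u₁ (≤-reflexive (sym |L₁|≡4))
  in h ∘ g ,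
     (λ p q → g-injective p q ∘ h-injective (g p) (g q)) ,
     λ p → let φ , φ₀≐gp , φₙ≐hgp = h-extends (g p)
               p#φ₀ = Disjoint-respʳ p (g p) (col φ zero) (g-disjoint p) (sym φ₀≐gp)
           in cons p φ p#φ₀ , refl , φₙ≐hgp
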